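{- Let $n$ and $k$ be positive integers, let $\lambda^\circ=((n),\ldots,(n))$ be the $k$-tuple of single-row partitions of length $n$, and let $\mu$ be a partition of weight $kn$. Consider the set $\mathrm{Tab}_{\lambda^\circ,\mu}$ of $k$-tuples of semi-standard single-row tableaux of shape $\lambda^\circ$ and weight $\mu$, partitioned into diagonal classes $D_{\lambda^\circ,\mu}(d)$. \begin{itemize} \item If every part of $\mu$ is divisible by $k$, then: (1) there is a unique diagonal class $D_{\lambda^\circ,\mu}(d)$ having exactly one element $T^\circ=(T^{\circ_1},\ldots,T^{\circ_k})$; (2) for each $i\in\{1,\ldots,n\}$, the $i$-th cell of each single-row tableau $T^{\circ_j}$ ($j=1,\ldots,k$) is filled with the same value; (3) $\mathrm{Inv}(T^\circ)=0$ and $\widetilde{I}_{\lambda^\circ,\mu}(q;d)=1$. \item If some part of $\mu$ is not divisible by $k$, then there is no diagonal class $D_{\lambda^\circ,\mu}(d)$ with only one element. \end{itemize}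
   Context: For a $k$-tuple $T^\circ=(T^{\circ_1},\ldots,T^{\circ_k})$ of semi-standard Young tableaux (weakly increasing rows, strictly increasing columns) with positive integer entries, the weight of $T^\circ$ is the composition $(\mu_1,\mu_2,\ldots)$ where $\mu_i$ is the total number of entries equal to $i$ in all the $T^{\circ_j}$. $\mathrm{Tab}_{\lambda^\circ,\mu}$ denotes the set of such $k$-tuples with $T^{\circ_j}$ of shape $\lambda^{\circ_j}$ and weight $\mu$. For a cell $s$ of $T^\circ$: $\mathrm{pos}(s)$ is the index $j$ with $s$ in $T^{\circ_j}$; $T^\circ(s)$ is its label; $\mathrm{row}(s)$, $\mathrm{col}(s)$ are its row and column in $T^{\circ_{\mathrm{pos}(s)}}$; $\mathrm{diag}(s)=\mathrm{col}(s)-\mathrm{row}(s)$. Inversions: a pair of cells $(s,t)$ is an inversion of $T^\circ$ if (1) either $\mathrm{diag}(s)=\mathrm{diag}(t)$ and $\mathrm{pos}(s)<\mathrm{pos}(t)$, or $\mathrm{diag}(s)=\mathrm{diag}(t)-1$ and $\mathrm{pos}(s)>\mathrm{pos}(t)$; (2) $\mathrm{row}(s)\le\mathrm{row}(t)$; (3) $T^\circ(t)<T^\circ(s)<T^\circ(t^\uparrow)$, where $t^\uparrow$ is the cell directly above $t$ and $T^\circ(t^\uparrow)=\infty$ if there is no such cell (for single-row tableaux there is never such a cell). $\mathrm{Inv}(T^\circ)$ is the number of inversions. Diagonal classes: for $\lambda^\circ=((n),\ldots,(n))$ and $i\in\{0,\ldots,n-1\}$, let $d_i$ be the multiset $\{T^\circ(s):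 \mathrm{diag}(s)=i\}$; the diagonal vector of $T^\circ$ is $d_{T^\circ}=(d_0,\ldots,d_{n-1})$. For a diagonal vector $d$, the diagonal class $D_{\lambda^\circ,\mu}(d)$ is the set of $T^\circ\in\mathrm{Tab}_{\lambda^\circ,\mu}$ with $d_{T^\circ}=d$, and $\widetilde{I}_{\lambda^\circ,\mu}(q;d)=\sum_{T^\circ\in D_{\lambda^\circ,\mu}(d)} q^{\mathrm{Inv}(T^\circ)}$. -}

module Defs where

open import Data.Nat using (ℕ; zero; suc; _+_; _*_; _^_; _≤_; _<_; _>_)
open import Data.Nat.Properties using (_≟_; _<?_)
open import Data.Fin using (Fin; toℕ)
open import Data.Vec as Vec using (Vec)
open import Data.List using (List; []; _∷_; length; filter; map; cartesianProduct; allFin)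
open import Data.Nat.ListAction using (sum)
open import Data.List.Relation.Unary.All using (All)
open import Data.List.Relation.Unary.Linked using (Linked)
open import Data.List.Relation.Unary.Unique.Propositional using (Unique)
open import Data.List.Membership.Propositional using (_∈_)
open import Data.List.Relation.Binary.Permutation.Propositional using (_↭_)
open import Data.Product using (Σ; _×_; _,_; proj₁; proj₂)
open import Data.Sum using (_⊎_)
open import Relation.Binary.PropositionalEquality using (_≡_)
open import Relation.Nullary using (Dec)
open import Relation.Nullary.Decidable using (_×-dec_; _⊎-dec_)
open import Function.Bundles using (_⇔_)

IsPartition : ℕ → List ℕ → Set
IsPartition m μ = All (λ p → 1 ≤ p) μ × Linked (λ a b → b ≤ a) μ × sum μ ≡ m

-- μ_i (1-based), with μ_i = 0 beyond the length of μ.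
part : List ℕ → ℕ → ℕ
part []      _       = 0
part (p ∷ μ) zero    = 0
part (p ∷ μ) (suc zero) = p
part (p ∷ μ) (suc (suc i)) = part μ (suc i)

-- A k-tuple of single-row fillings of shape ((n),...,(n)):
-- T[j][c] is the entry in column c (0-based) of the j-th tableau T^{∘_{j+1}}.
Tuple : ℕ → ℕ → Set
Tuple k n = Vec (Vec ℕ n) k

entry : ∀ {k n} → Tuple k n → Fin k → Fin n → ℕ
entry T j c = Vec.lookup (Vec.lookup T j) c

entries : ∀ {k n} → Tuple k n → List ℕ
entries T = Vec.toList (Vec.concat T)

mult : ∀ {k n} → ℕ → Tuple k n → ℕ
mult v T = length (filter (λ x → x ≟ v) (entries T))

IsSSYTRows : ∀ {k n} → Tuple k n → Set
IsSSYTRows {k} {n} T =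
  (∀ (j : Fin k) (c : Fin n) → 1 ≤ entry T j c) ×
  (∀ (j : Fin k) (c c' : Fin n) → toℕ c ≤ toℕ c' → entry T j c ≤ entry T j c')

Tab : ∀ k n → List ℕ → Tuple k n → Set
Tab k n μ T = IsSSYTRows T × (∀ (i : ℕ) → mult i T ≡ part μ i)

-- diagonal vector: for single rows diag(s) = col(s) - 1, so d_i is the
-- multiset of entries of column i (0-based) over all k tableaux, as a list.
diagOf : ∀ {k n} → Tuple k n → Fin n → List ℕ
diagOf T i = Vec.toList (Vec.map (λ row → Vec.lookup row i) T)

-- diagonal vectors: multisets represented by lists, compared up to permutation
DiagVec : ℕ → Set
DiagVec n = Fin n → List ℕ

InClass : ∀ k n → List ℕ → DiagVec n → Tuple k n → Set
InClass k n μ d T = Tab k n μ T × (∀ i → diagOf T i ↭ d i)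

SingletonClass : ∀ k n → List ℕ → DiagVec n → Set
SingletonClass k n μ d =
  Σ (Tuple k n) λ T → InClass k n μ d T × (∀ T' → InClass k n μ d T' → T' ≡ T)

-- Inversions, specialised to single-row tableaux: cells s = (j,c), t = (j',c')
-- (pos = j, col = c, row = 1, diag = col - 1).  Condition (2) row(s) ≤ row(t)
-- always holds, and t has no cell above, so (3) reads T(t) < T(s).
Cell : ℕ → ℕ → Set
Cell k n = Fin k × Fin n

IsInversion : ∀ {k n} → Tuple k n → Cell k n × Cell k n → Set
IsInversion T ((j , c) , (j' , c')) =
  ((toℕ c ≡ toℕ c' × toℕ j < toℕ j') ⊎ (suc (toℕ c) ≡ toℕ c' × toℕ j > toℕ j'))
  × entry T j' c' < entry T j c

isInversion? : ∀ {k n} (T : Tuple k n) (p : Cell k n × Cell k n) → Dec (IsInversion T p)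
isInversion? T ((j , c) , (j' , c')) =
  (((toℕ c ≟ toℕ c') ×-dec (toℕ j <? toℕ j'))
     ⊎-dec ((suc (toℕ c) ≟ toℕ c') ×-dec (toℕ j' <? toℕ j)))
  ×-dec (entry T j' c' <? entry T j c)

cells : ∀ k n → List (Cell k n)
cells k n = cartesianProduct (allFin k) (allFin n)

Inv : ∀ {k n} → Tuple k n → ℕ
Inv {k} {n} T = length (filter (isInversion? T) (cartesianProduct (cells k n) (cells k n)))

Enumerates : ∀ k n → List ℕ → DiagVec n → List (Tuple k n) → Set
Enumerates k n μ d L = Unique L × (∀ T → (InClass k n μ d T ⇔ T ∈ L))

-- f is Ĩ_{λ°,μ}(q;d) = Σ_{T ∈ D(d)} q^{Inv T}, as a function of q ∈ ℕ
-- (the class is finite: some duplicate-free enumeration exists, and the sum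
-- along every such enumeration equals f q).
ItildeIs : ∀ k n → List ℕ → DiagVec n → (ℕ → ℕ) → Set
ItildeIs k n μ d f =
  Σ (List (Tuple k n)) (Enumerates k n μ d) ×
  ∀ (L : List (Tuple k n)) → Enumerates k n μ d L →
    ∀ (q : ℕ) → f q ≡ sum (map (λ T → q ^ Inv T) L)

-- A tuple that is the only member of its diagonal class is fixed by every permutation of
-- its rows, because permuting rows preserves the SSYT conditions, the weight and every
-- diagonal multiset; hence all k rows coincide, every value occurs a multiple of k times,
-- and no part of μ can fail to be divisible by k.  Conversely, if μ = k·q, the k copies of
-- the sorted row containing q_i copies of i form a class on their own: its diagonals are
-- constant, so they pin down every entry.  Any other singleton class consists of k copies
-- of a sorted row with the same multiplicities, i.e. of the same row.  A constant-column
-- tuple with weakly increasing rows has no inversions, so Ĩ = q⁰ = 1.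
module Submission where

open import Defs
open import Data.Nat using (ℕ; zero; suc; _+_; _*_; _^_; _≤_; _<_; z≤n; s≤s)
open import Data.Nat.Properties
  using (_≟_; ≤-refl; ≤-reflexive; ≤-trans; ≤-antisym; n≤1+n; ≤⇒≯; <⇒≢; >⇒≢; m<m+n;
         ≤-totalOrder; suc-injective; +-suc; +-identityʳ; *-comm; *-distribʳ-+;
         *-cancelˡ-≡; *-cancelʳ-≡)
open import Data.Nat.Divisibility using (_∣_; divides)
open import Data.Nat.ListAction using (sum)
open import Data.Nat.ListAction.Properties using (sum-↭)
open import Data.Fin as F using (Fin; toℕ)
open import Data.Vec as V using (Vec; _∷_; [])
open import Data.Vec.Properties
  using (toList-++; toList-map; toList∘fromList; lookup-map; lookup-replicate;
         tabulate∘lookup; tabulate-cong)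
open import Data.Vec.Membership.Propositional using () renaming (_∈_ to _∈ᵥ_)
open import Data.Vec.Membership.Propositional.Properties using (∈-toList⁺)
import Data.Vec.Membership.Propositional.Properties as VecMembership
import Data.Vec.Relation.Unary.All.Properties as VecAll
open import Data.List as L using (List; []; _∷_; _++_; length; filter; replicate)
open import Data.List.Properties
  using (filter-++; filter-accept; filter-reject; filter-all; filter-none; length-++;
         length-replicate)
open import Data.List.Membership.Propositional using (_∈_)
import Data.List.Membership.Propositional.Properties as ListMembership
open import Data.List.Relation.Unary.All as All using (All; []; _∷_)
open import Data.List.Relation.Unary.All.Properties using (Any¬⇒¬All)
import Data.List.Relation.Unary.All.Properties as AllProp
open import Data.List.Relation.Unary.Any using (Any; here; there)
open import Data.List.Relation.Unary.AllPairs using (AllPairs; []; _∷_)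
import Data.List.Relation.Unary.AllPairs.Properties as AllPairsProp
open import Data.List.Relation.Unary.Sorted.TotalOrder ≤-totalOrder using (Sorted)
open import Data.List.Relation.Unary.Sorted.TotalOrder.Properties
  using (AllPairs⇒Sorted; lookup-mono-≤)
open import Data.List.Relation.Unary.Unique.Propositional using (Unique)
open import Data.List.Relation.Binary.Permutation.Propositional
  using (_↭_; prep; swap; ↭-refl; ↭-sym; ↭-trans)
open import Data.List.Relation.Binary.Permutation.Propositional.Properties
  using (All-resp-↭; ∈-resp-↭; map⁺)
open import Data.Product using (Σ; ∃; _×_; _,_; proj₁; proj₂)
open import Data.Sum using (inj₁; inj₂)
open import Function using (_∘_)
open import Function.Bundles using (mk⇔; Equivalence)
open import Relation.Binary.PropositionalEquality
open import Relation.Nullary using (¬_; yes; no; contradiction)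

count : ℕ → List ℕ → ℕ
count v xs = length (filter (_≟ v) xs)

count-++ : ∀ v xs ys → count v (xs ++ ys) ≡ count v xs + count v ys
count-++ v xs ys = trans (cong length (filter-++ (_≟ v) xs ys)) (length-++ (filter (_≟ v) xs))

count-accept : ∀ {v x} xs → x ≡ v → count v (x ∷ xs) ≡ suc (count v xs)
count-accept _ x≡v = cong length (filter-accept (_≟ _) x≡v)

count-reject : ∀ {v x} xs → x ≢ v → count v (x ∷ xs) ≡ count v xs
count-reject _ x≢v = cong length (filter-reject (_≟ _) x≢v)

count-replicate : ∀ q v → count v (replicate q v) ≡ q
count-replicate q v =
  trans (cong length (filter-all (_≟ v) (AllProp.replicate⁺ q refl))) (length-replicate q)

count-absent : ∀ {v} xs → All (_≢ v) xs → count v xs ≡ 0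
count-absent {v} _ xs≢v = cong length (filter-none (_≟ v) xs≢v)

count-∷-cancel : ∀ {v} x xs ys → count v (x ∷ xs) ≡ count v (x ∷ ys) → count v xs ≡ count v ys
count-∷-cancel {v} x xs ys same with x ≟ v
... | yes x≡v = suc-injective (trans (sym (count-accept xs x≡v)) (trans same (count-accept ys x≡v)))
... | no x≢v = trans (sym (count-reject xs x≢v)) (trans same (count-reject ys x≢v))

counted⇒∈ : ∀ {v} xs → 0 < count v xs → v ∈ xs
counted⇒∈ {v} (x ∷ xs) counted with x ≟ v
... | yes refl = here refl
... | no x≢v = there (counted⇒∈ xs (subst (0 <_) (count-reject xs x≢v) counted))

count-head-pos : ∀ x xs → 0 < count x (x ∷ xs)
count-head-pos x xs = subst (0 <_) (sym (count-accept {x} xs refl)) (s≤s z≤n)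

lookup-ext : ∀ {A : Set} {m} (xs ys : Vec A m) → (∀ i → V.lookup xs i ≡ V.lookup ys i) → xs ≡ ys
lookup-ext xs ys xs≗ys = begin
  xs                       ≡⟨ tabulate∘lookup xs ⟨
  V.tabulate (V.lookup xs) ≡⟨ tabulate-cong xs≗ys ⟩
  V.tabulate (V.lookup ys) ≡⟨ tabulate∘lookup ys ⟩
  ys                       ∎
  where open ≡-Reasoning

lookup-const⇒replicate : ∀ {A : Set} {m} (xs : Vec A m) a → (∀ i → V.lookup xs i ≡ a) →
  xs ≡ V.replicate m a
lookup-const⇒replicate xs a xs≗a =
  lookup-ext xs _ (λ i → trans (xs≗a i) (sym (lookup-replicate i a)))

lookup-fromList : ∀ {A : Set} (xs : List A) i → V.lookup (V.fromList xs) i ≡ L.lookup xs i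
lookup-fromList (x ∷ xs) F.zero = refl
lookup-fromList (x ∷ xs) (F.suc i) = lookup-fromList xs i

lookup∷update-↭ : ∀ {A : Set} {m} (xs : Vec A m) j x →
  V.lookup xs j ∷ V.toList (xs V.[ j ]≔ x) ↭ x ∷ V.toList xs
lookup∷update-↭ (y ∷ ys) F.zero x = swap y x ↭-refl
lookup∷update-↭ (y ∷ ys) (F.suc j) x =
  ↭-trans (swap _ y ↭-refl) (↭-trans (prep y (lookup∷update-↭ ys j x)) (swap y x ↭-refl))

lookup-resp-↭ : ∀ {A : Set} {P : A → Set} {m} {xs ys : Vec A m} → V.toList ys ↭ V.toList xs →
  (∀ j → P (V.lookup xs j)) → ∀ j → P (V.lookup ys j)
lookup-resp-↭ {P = P} ys↭xs P-xs =
  VecAll.lookup⁺ {P = P}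
    (VecAll.toList⁻ (All-resp-↭ (↭-sym ys↭xs) (VecAll.toList⁺ (VecAll.lookup⁻ P-xs))))

Unique-singleton : ∀ {A : Set} {a : A} {xs} → Unique xs → (∀ {x} → x ∈ xs → x ≡ a) → a ∈ xs →
  xs ≡ a ∷ []
Unique-singleton {xs = x ∷ []} _ all≡a _ = cong (_∷ []) (all≡a (here refl))
Unique-singleton {xs = x ∷ y ∷ _} ((x≢y ∷ _) ∷ _) all≡a _ =
  contradiction (trans (all≡a (here refl)) (sym (all≡a (there (here refl))))) x≢y

rowCount : ℕ → ∀ {n} → Vec ℕ n → ℕ
rowCount v r = count v (V.toList r)

WeaklyIncreasing : ∀ {m} → Vec ℕ m → Set
WeaklyIncreasing {m} r = ∀ (c c' : Fin m) → toℕ c ≤ toℕ c' → V.lookup r c ≤ V.lookup r c'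

weaklyIncreasing-tail : ∀ {m x} {xs : Vec ℕ m} → WeaklyIncreasing (x ∷ xs) → WeaklyIncreasing xs
weaklyIncreasing-tail r↑ c c' c≤c' = r↑ (F.suc c) (F.suc c') (s≤s c≤c')

head-≤-counted : ∀ {m x v} {xs : Vec ℕ m} → WeaklyIncreasing (x ∷ xs) →
  0 < rowCount v (x ∷ xs) → x ≤ v
head-≤-counted {x = x} {xs = xs} r↑ counted =
  All.lookup x≤all (counted⇒∈ (V.toList (x ∷ xs)) counted)
  where
  x≤all : All (x ≤_) (V.toList (x ∷ xs))
  x≤all = VecAll.toList⁺ (VecAll.lookup⁻ (λ c → r↑ F.zero c z≤n))

weaklyIncreasing-count-injective : ∀ {m} {r s : Vec ℕ m} → WeaklyIncreasing r → WeaklyIncreasing s →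
  (∀ v → rowCount v r ≡ rowCount v s) → r ≡ s
weaklyIncreasing-count-injective {r = []} {[]} _ _ _ = refl
weaklyIncreasing-count-injective {r = x ∷ xs} {y ∷ ys} r↑ s↑ same
  with refl ← ≤-antisym
                (head-≤-counted r↑ (subst (0 <_) (sym (same y)) (count-head-pos y (V.toList ys))))
                (head-≤-counted s↑ (subst (0 <_) (same x) (count-head-pos x (V.toList xs))))
  = cong (x ∷_) (weaklyIncreasing-count-injective
                   (weaklyIncreasing-tail r↑) (weaklyIncreasing-tail s↑)
                   (λ v → count-∷-cancel x (V.toList xs) (V.toList ys) (same v)))

fromList-weaklyIncreasing : ∀ {xs} → Sorted xs → WeaklyIncreasing (V.fromList xs)
fromList-weaklyIncreasing {xs} xs↗ c c' c≤c' =
  subst₂ _≤_ (sym (lookup-fromList xs c)) (sym (lookup-fromList xs c'))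
    (lookup-mono-≤ ≤-totalOrder xs↗ {c} {c'} c≤c')

IsSSYTRow : ∀ {m} → Vec ℕ m → Set
IsSSYTRow r = (∀ c → 1 ≤ V.lookup r c) × WeaklyIncreasing r

IsSSYTRows⇒rows : ∀ {k n} {T : Tuple k n} → IsSSYTRows T → ∀ j → IsSSYTRow (V.lookup T j)
IsSSYTRows⇒rows (positive , increasing) j = positive j , increasing j

rows⇒IsSSYTRows : ∀ {k n} {T : Tuple k n} → (∀ j → IsSSYTRow (V.lookup T j)) → IsSSYTRows T
rows⇒IsSSYTRows rows = (λ j → proj₁ (rows j)) , (λ j → proj₂ (rows j))

mult-∷ : ∀ {k n} v r (T : Tuple k n) → mult v (r ∷ T) ≡ rowCount v r + mult v T
mult-∷ v r T = trans (cong (count v) (toList-++ r (V.concat T))) (count-++ v (V.toList r) _)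

mult-rows : ∀ {k n} v (T : Tuple k n) → mult v T ≡ sum (L.map (rowCount v) (V.toList T))
mult-rows v [] = refl
mult-rows v (r ∷ T) = trans (mult-∷ v r T) (cong (rowCount v r +_) (mult-rows v T))

mult-replicate : ∀ k {n} v (r : Vec ℕ n) → mult v (V.replicate k r) ≡ k * rowCount v r
mult-replicate zero v r = refl
mult-replicate (suc k) v r =
  trans (mult-∷ v r (V.replicate k r)) (cong (rowCount v r +_) (mult-replicate k v r))

diagOf-resp-rows↭ : ∀ {k n} {T T' : Tuple k n} → V.toList T' ↭ V.toList T → ∀ i →
  diagOf T' i ↭ diagOf T i
diagOf-resp-rows↭ {T = T} {T'} T'↭T i =
  subst₂ _↭_ (sym (toList-map column T')) (sym (toList-map column T)) (map⁺ column T'↭T)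
  where
  column : Vec ℕ _ → ℕ
  column row = V.lookup row i

InClass-resp-rows↭ : ∀ {k n μ d} {T T' : Tuple k n} → V.toList T' ↭ V.toList T →
  InClass k n μ d T → InClass k n μ d T'
InClass-resp-rows↭ {μ = μ} {T = T} {T'} T'↭T ((ssytT , weightT) , diagT) =
  (ssytT' , weightT') , λ i → ↭-trans (diagOf-resp-rows↭ T'↭T i) (diagT i)
  where
  ssytT' : IsSSYTRows T'
  ssytT' = rows⇒IsSSYTRows {T = T'}
    (lookup-resp-↭ {P = IsSSYTRow} T'↭T (IsSSYTRows⇒rows {T = T} ssytT))
  weightT' : ∀ v → mult v T' ≡ part μ v
  weightT' v = begin
    mult v T'                                ≡⟨ mult-rows v T' ⟩
    sum (L.map (rowCount v) (V.toList T'))   ≡⟨ sum-↭ (map⁺ (rowCount v) T'↭T) ⟩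
    sum (L.map (rowCount v) (V.toList T))    ≡⟨ mult-rows v T ⟨
    mult v T                                 ≡⟨ weightT v ⟩
    part μ v                                 ∎
    where open ≡-Reasoning

singleton⇒replicated : ∀ {k n μ d} (T : Tuple (suc k) n) → InClass (suc k) n μ d T →
  (∀ T' → InClass (suc k) n μ d T' → T' ≡ T) → T ≡ V.replicate (suc k) (V.lookup T F.zero)
singleton⇒replicated {μ = μ} {d} (r ∷ rest) inT unique =
  lookup-const⇒replicate (r ∷ rest) r row≡r
  where
  row≡r : ∀ j → V.lookup (r ∷ rest) j ≡ r
  row≡r F.zero = refl
  row≡r (F.suc j) =
    cong V.head (unique _ (InClass-resp-rows↭ {μ = μ} {d = d} (lookup∷update-↭ rest j r) inT))

singleton-weight : ∀ {k n μ d} (T : Tuple (suc k) n) → InClass (suc k) n μ d T →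
  (∀ T' → InClass (suc k) n μ d T' → T' ≡ T) →
  ∀ v → suc k * rowCount v (V.lookup T F.zero) ≡ part μ v
singleton-weight {k} {μ = μ} {d} T inT@((_ , weightT) , _) unique v = begin
  suc k * rowCount v r             ≡⟨ mult-replicate (suc k) v r ⟨
  mult v (V.replicate (suc k) r)   ≡⟨ cong (mult v) (singleton⇒replicated {μ = μ} {d} T inT unique) ⟨
  mult v T                         ≡⟨ weightT v ⟩
  part μ v                         ∎
  where
  open ≡-Reasoning
  r : Vec ℕ _
  r = V.lookup T F.zero

singleton⇒part-divisible : ∀ {k n μ d} → SingletonClass (suc k) n μ d → ∀ v → suc k ∣ part μ v
singleton⇒part-divisible {k} {μ = μ} {d} (T , inT , unique) v =
  divides (rowCount v (V.lookup T F.zero))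
    (trans (sym (singleton-weight {μ = μ} {d} T inT unique v)) (*-comm (suc k) _))

UniqueSingletonClass : ℕ → ℕ → List ℕ → Set
UniqueSingletonClass k n μ =
  Σ (DiagVec n) λ d → Σ (Tuple k n) λ T →
    (InClass k n μ d T × (∀ T' → InClass k n μ d T' → T' ≡ T))
    × (∀ (d' : DiagVec n) → SingletonClass k n μ d' → ∀ i → d' i ↭ d i)
    × (∀ (i : Fin n) (j j' : Fin k) → entry T j i ≡ entry T j' i)
    × Inv T ≡ 0
    × ItildeIs k n μ d (λ _ → 1)

entry-replicate : ∀ k {n} (r : Vec ℕ n) j c → entry (V.replicate k r) j c ≡ V.lookup r c
entry-replicate k r j c = cong (λ row → V.lookup row c) (lookup-replicate j r)

entry-∈-diagOf : ∀ {k n} (T : Tuple k n) j c → entry T j c ∈ diagOf T c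
entry-∈-diagOf T j c =
  ∈-toList⁺ (subst (_∈ᵥ V.map column T) (lookup-map j column T)
                   (VecMembership.∈-lookup j (V.map column T)))
  where
  column : Vec ℕ _ → ℕ
  column row = V.lookup row c

diagOf-replicate : ∀ k {n} (r : Vec ℕ n) c → All (_≡ V.lookup r c) (diagOf (V.replicate k r) c)
diagOf-replicate k r c = VecAll.toList⁺ (VecAll.lookup⁻ λ j →
  trans (lookup-map j (λ row → V.lookup row c) (V.replicate k r)) (entry-replicate k r j c))

diagOf-replicate-determines : ∀ {k n μ} (r : Vec ℕ n) (T : Tuple k n) →
  InClass k n μ (diagOf (V.replicate k r)) T → T ≡ V.replicate k r
diagOf-replicate-determines {k} r T (_ , diagT) =
  lookup-const⇒replicate T r λ j → lookup-ext _ r λ c →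
    All.lookup (diagOf-replicate k r c) (∈-resp-↭ (diagT c) (entry-∈-diagOf T j c))

inversion-columns-≤ : ∀ {k n} (T : Tuple k n) {j j' c c'} → IsInversion T ((j , c) , (j' , c')) →
  toℕ c ≤ toℕ c'
inversion-columns-≤ T (inj₁ (c≡c' , _) , _) = ≤-reflexive c≡c'
inversion-columns-≤ T {c = c} (inj₂ (1+c≡c' , _) , _) = subst (toℕ c ≤_) 1+c≡c' (n≤1+n (toℕ c))

replicate-no-inversion : ∀ k {n} (r : Vec ℕ n) → WeaklyIncreasing r →
  ∀ p → ¬ IsInversion (V.replicate k r) p
replicate-no-inversion k r r↑ ((j , c) , (j' , c')) inv@(_ , decreasing) =
  ≤⇒≯ (r↑ c c' (inversion-columns-≤ (V.replicate k r) inv))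
      (subst₂ _<_ (entry-replicate k r j' c') (entry-replicate k r j c) decreasing)

Inv≡0 : ∀ {k n} (T : Tuple k n) → (∀ p → ¬ IsInversion T p) → Inv T ≡ 0
Inv≡0 {k} {n} T noInversion =
  cong length (filter-none (isInversion? T)
    (All.universal noInversion (L.cartesianProduct (cells k n) (cells k n))))

singleton-Itilde : ∀ {k n μ d} (T : Tuple k n) → InClass k n μ d T →
  (∀ T' → InClass k n μ d T' → T' ≡ T) → Inv T ≡ 0 → ItildeIs k n μ d (λ _ → 1)
singleton-Itilde {k} {n} {μ} {d} T inT unique noInversions = (T ∷ [] , enumerates) , sum≡1
  where
  enumerates : Enumerates k n μ d (T ∷ [])
  enumerates = ([] ∷ []) , λ T' → mk⇔ (λ inT' → here (unique T' inT')) λ { (here refl) → inT }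
  sum≡1 : ∀ Ts → Enumerates k n μ d Ts → ∀ q → 1 ≡ sum (L.map (λ T → q ^ Inv T) Ts)
  sum≡1 Ts (uniqueTs , Ts⇔) q
    rewrite Unique-singleton uniqueTs (λ T'∈Ts → unique _ (Equivalence.from (Ts⇔ _) T'∈Ts))
                                      (Equivalence.to (Ts⇔ T) inT)
          | noInversions = refl

replicated-uniqueSingletonClass : ∀ k {n μ} (r : Vec ℕ n) → IsSSYTRow r →
  (∀ v → suc k * rowCount v r ≡ part μ v) → UniqueSingletonClass (suc k) n μ
replicated-uniqueSingletonClass k {n} {μ} r r-ssyt@(_ , r↑) weight =
  diagOf T , T , (inT , determined) , singletons , constantColumns , noInversions ,
  singleton-Itilde {μ = μ} T inT determined noInversions
  where
  T : Tuple (suc k) n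
  T = V.replicate (suc k) r
  inT : InClass (suc k) n μ (diagOf T) T
  inT = (rows⇒IsSSYTRows {T = T} (λ j → subst IsSSYTRow (sym (lookup-replicate j r)) r-ssyt) ,
         λ v → trans (mult-replicate (suc k) v r) (weight v)) ,
        λ _ → ↭-refl
  determined : ∀ T' → InClass (suc k) n μ (diagOf T) T' → T' ≡ T
  determined = diagOf-replicate-determines {μ = μ} r
  constantColumns : ∀ i j j' → entry T j i ≡ entry T j' i
  constantColumns i j j' =
    trans (entry-replicate (suc k) r j i) (sym (entry-replicate (suc k) r j' i))
  noInversions : Inv T ≡ 0
  noInversions = Inv≡0 T (replicate-no-inversion (suc k) r r↑)
  singletons : ∀ d' → SingletonClass (suc k) n μ d' → ∀ i → d' i ↭ diagOf T i
  singletons d' (T' , inT'@((ssytT' , _) , diagT') , unique') i =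
    subst (λ X → d' i ↭ diagOf X i) T'≡T (↭-sym (diagT' i))
    where
    r' : Vec ℕ n
    r' = V.lookup T' F.zero
    r'↑ : WeaklyIncreasing r'
    r'↑ = proj₂ (IsSSYTRows⇒rows {T = T'} ssytT' F.zero)
    sameCounts : ∀ v → rowCount v r' ≡ rowCount v r
    sameCounts v = *-cancelˡ-≡ _ _ (suc k)
      (trans (singleton-weight {μ = μ} {d'} T' inT' unique' v) (sym (weight v)))
    T'≡T : T' ≡ T
    T'≡T = trans (singleton⇒replicated {μ = μ} {d'} T' inT' unique')
                 (cong (V.replicate (suc k))
                   (weaklyIncreasing-count-injective r'↑ r↑ sameCounts))

staircase : ℕ → List ℕ → List ℕ
staircase i [] = []
staircase i (q ∷ qs) = replicate q i ++ staircase (suc i) qs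

staircase-≥ : ∀ i qs → All (i ≤_) (staircase i qs)
staircase-≥ i [] = []
staircase-≥ i (q ∷ qs) =
  AllProp.++⁺ (AllProp.replicate⁺ q ≤-refl) (All.map (≤-trans (n≤1+n i)) (staircase-≥ (suc i) qs))

staircase-≢ : ∀ i qs → All (_≢ i) (staircase (suc i) qs)
staircase-≢ i qs = All.map >⇒≢ (staircase-≥ (suc i) qs)

replicate-AllPairs-≤ : ∀ q {i} → AllPairs _≤_ (replicate q i)
replicate-AllPairs-≤ zero = []
replicate-AllPairs-≤ (suc q) = AllProp.replicate⁺ q ≤-refl ∷ replicate-AllPairs-≤ q

staircase-sorted : ∀ i qs → Sorted (staircase i qs)
staircase-sorted i qs = AllPairs⇒Sorted ≤-totalOrder (pairs i qs)
  where
  pairs : ∀ i qs → AllPairs _≤_ (staircase i qs)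
  pairs i [] = []
  pairs i (q ∷ qs) = AllPairsProp.++⁺ (replicate-AllPairs-≤ q) (pairs (suc i) qs)
    (AllProp.replicate⁺ q (All.map (≤-trans (n≤1+n i)) (staircase-≥ (suc i) qs)))

length-staircase : ∀ i qs → length (staircase i qs) ≡ sum qs
length-staircase i [] = refl
length-staircase i (q ∷ qs) =
  trans (length-++ (replicate q i)) (cong₂ _+_ (length-replicate q) (length-staircase (suc i) qs))

count-staircase : ∀ i qs v → count (i + v) (staircase (suc i) qs) ≡ part qs v
count-staircase i [] v = refl
count-staircase i (q ∷ qs) zero rewrite +-identityʳ i = count-absent _ (staircase-≢ i (q ∷ qs))
count-staircase i (q ∷ qs) (suc zero) rewrite +-suc i 0 | +-identityʳ i = begin
  count (suc i) (replicate q (suc i) ++ staircase (suc (suc i)) qs)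
    ≡⟨ count-++ (suc i) (replicate q (suc i)) _ ⟩
  count (suc i) (replicate q (suc i)) + count (suc i) (staircase (suc (suc i)) qs)
    ≡⟨ cong₂ _+_ (count-replicate q (suc i)) (count-absent _ (staircase-≢ (suc i) qs)) ⟩
  q + 0
    ≡⟨ +-identityʳ q ⟩
  q ∎
  where open ≡-Reasoning
count-staircase i (q ∷ qs) (suc (suc v)) rewrite +-suc i (suc v) =
  trans (count-++ _ (replicate q (suc i)) _)
        (cong₂ _+_ (count-absent _ (AllProp.replicate⁺ q (<⇒≢ (s≤s (m<m+n i (s≤s z≤n))))))
                   (count-staircase (suc i) qs (suc v)))

part-map-* : ∀ k qs v → part (L.map (_* k) qs) v ≡ part qs v * k
part-map-* k [] v = refl
part-map-* k (q ∷ qs) zero = refl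
part-map-* k (q ∷ qs) (suc zero) = refl
part-map-* k (q ∷ qs) (suc (suc v)) = part-map-* k qs (suc v)

sum-map-* : ∀ k qs → sum (L.map (_* k) qs) ≡ sum qs * k
sum-map-* k [] = refl
sum-map-* k (q ∷ qs) = trans (cong (q * k +_) (sum-map-* k qs)) (sym (*-distribʳ-+ k q (sum qs)))

All-∣⇒map-* : ∀ {k} μ → All (k ∣_) μ → ∃ λ qs → μ ≡ L.map (_* k) qs
All-∣⇒map-* [] [] = [] , refl
All-∣⇒map-* (p ∷ μ) (divides q p≡q*k ∷ μ-divisible) with qs , refl ← All-∣⇒map-* μ μ-divisible =
  q ∷ qs , cong (_∷ L.map (_* _) qs) p≡q*k

staircase-uniqueSingletonClass : ∀ k qs →
  UniqueSingletonClass (suc k) (length (staircase 1 qs)) (L.map (_* suc k) qs)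
staircase-uniqueSingletonClass k qs =
  replicated-uniqueSingletonClass k {μ = L.map (_* suc k) qs} (V.fromList row)
    (positive , fromList-weaklyIncreasing (staircase-sorted 1 qs)) weight
  where
  row : List ℕ
  row = staircase 1 qs
  positive : ∀ c → 1 ≤ V.lookup (V.fromList row) c
  positive c = subst (1 ≤_) (sym (lookup-fromList row c))
    (All.lookup (staircase-≥ 1 qs) (ListMembership.∈-lookup c))
  weight : ∀ v → suc k * rowCount v (V.fromList row) ≡ part (L.map (_* suc k) qs) v
  weight v = begin
    suc k * count v (V.toList (V.fromList row)) ≡⟨ cong (λ xs → suc k * count v xs)
                                                         (toList∘fromList row) ⟩
    suc k * count v row                         ≡⟨ cong (suc k *_) (count-staircase 0 qs v) ⟩
    suc k * part qs v                           ≡⟨ *-comm (suc k) _ ⟩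
    part qs v * suc k                           ≡⟨ part-map-* (suc k) qs v ⟨
    part (L.map (_* suc k) qs) v                ∎
    where open ≡-Reasoning

divisible⇒uniqueSingletonClass : ∀ n k μ → sum μ ≡ suc k * n → All (suc k ∣_) μ →
  UniqueSingletonClass (suc k) n μ
divisible⇒uniqueSingletonClass n k μ sumμ divisible with qs , refl ← All-∣⇒map-* μ divisible =
  subst (λ m → UniqueSingletonClass (suc k) m (L.map (_* suc k) qs)) length≡n
    (staircase-uniqueSingletonClass k qs)
  where
  length≡n : length (staircase 1 qs) ≡ n
  length≡n = trans (length-staircase 1 qs)
    (*-cancelʳ-≡ _ n (suc k) (trans (sym (sum-map-* (suc k) qs)) (trans sumμ (*-comm (suc k) n))))

All-from-part : ∀ {P : ℕ → Set} μ → (∀ i → P (part μ (suc i))) → All P μ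
All-from-part [] _ = []
All-from-part (p ∷ μ) P-parts = P-parts 0 ∷ All-from-part μ (P-parts ∘ suc)

proposition3 : ∀ (n k : ℕ) → 1 ≤ n → 1 ≤ k → (μ : List ℕ) → IsPartition (k * n) μ →
    (All (λ p → k ∣ p) μ →
      Σ (DiagVec n) λ d → Σ (Tuple k n) λ T →
        (InClass k n μ d T × (∀ T' → InClass k n μ d T' → T' ≡ T))
        × (∀ (d' : DiagVec n) → SingletonClass k n μ d' → ∀ i → d' i ↭ d i)
        × (∀ (i : Fin n) (j j' : Fin k) → entry T j i ≡ entry T j' i)
        × Inv T ≡ 0
        × ItildeIs k n μ d (λ _ → 1))
    × (Any (λ p → ¬ (k ∣ p)) μ → ∀ (d : DiagVec n) → ¬ SingletonClass k n μ d)
proposition3 n (suc k) _ (s≤s z≤n) μ (_ , _ , sumμ) =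
  divisible⇒uniqueSingletonClass n k μ sumμ ,
  λ someIndivisible d singleton → Any¬⇒¬All someIndivisible
    (All-from-part μ (λ i → singleton⇒part-divisible {μ = μ} {d} singleton (suc i)))
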